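{- For every positive integer $n$, the number of lattice rectangles contained in the Aztec diamond of order $n$ is \[ a(n)=9\binom{n+3}{4}+6\binom{n+2}{4}+\binom{n+1}{4}=\frac{n(n+1)(4n^{2}+12n+11)}{6}. \]
   Context: A lattice rectangle is a set $[x,x']\times[y,y']\subseteq\mathbb{R}^2$ with $x<x'$, $y<y'$ and $x,x',y,y'\in\mathbb{Z}$ (squares included). A unit lattice square is a lattice rectangle with all sides of length $1$. For a positive integer $n$, the Aztec diamond of order $n$ is the union of the unit lattice squares $[i,i+1]\times[j,j+1]$ ($i,j\in\mathbb{Z}$) satisfying $|i+\tfrac12|+|j+\tfrac12|\le n$; equivalently, it is formed by $2n$ stacked rows of consecutive unit lattice squares, with row centers vertically aligned, of lengths $2,4,\ldots,2n,2n,\ldots,4,2$. The count is of lattice rectangles that are subsets of this region. Binomial coefficients $\binom{m}{4}$ are $0$ when $m<4$. -}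

module Defs where

open import Data.Nat using (ℕ) renaming (_≤_ to _≤ℕ_; _+_ to _+ℕ_; _*_ to _*ℕ_)
open import Data.Integer using (ℤ; +_; ∣_∣; _≤_; _<_; _+_; _*_; 1ℤ)
open import Data.Product using (_×_)

-- The unit lattice square [i,i+1]×[j,j+1] belongs to the Aztec diamond of
-- order n iff |i+1/2| + |j+1/2| ≤ n, i.e. (multiplying by 2)
-- |2i+1| + |2j+1| ≤ 2n.
InAztecCell : ℕ → ℤ → ℤ → Set
InAztecCell n i j = ∣ ((+ 2) * i) + 1ℤ ∣ +ℕ ∣ ((+ 2) * j) + 1ℤ ∣ ≤ℕ 2 *ℕ n

record LatticeRect : Set where
  constructor rect
  field
    x x' y y' : ℤ

ContainedInAztec : ℕ → LatticeRect → Set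
ContainedInAztec n (rect x x' y y') =
  (x < x') × (y < y') ×
  (∀ (i j : ℤ) → x ≤ i → i < x' → y ≤ j → j < y' → InAztecCell n i j)

-- A unit square [i, i + 1] × [j, j + 1] lies in the Aztec diamond of order n iff κ i + κ j ≤ n + 1,
-- where κ i is the least r with [i, i + 1] ⊆ [-r, r]. As κ is largest at the two ends of an
-- interval, a lattice rectangle I × J lies in the diamond iff ρ I + ρ J ≤ n + 1, where ρ I is the
-- least r with I ⊆ [-r, r]. There are 4r - 1 lattice intervals of radius exactly r and m (2m + 1)
-- of radius at most m, so grouping the rectangles by the radius r of their x-side gives
-- Σ_{r=1}^{n} (4r - 1) · t (2t + 1) with t = n + 1 - r, which is n (n + 1) (4n² + 12n + 11) / 6;
-- the binomial form follows from 4! · C(m + 3, 4) = (m + 3)(m + 2)(m + 1) m.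

module Submission where

open import Defs
open import Data.Empty using (⊥-elim)
open import Data.Integer as ℤ using (ℤ; +_; -[1+_]; ∣_∣; 1ℤ; -≤-; -<-; -<+; +<+)
import Data.Integer.Properties as ℤₚ
import Data.Integer.Tactic.RingSolver as ℤSolver
open import Data.List using (List; []; _∷_; _++_; map; length; cartesianProductWith)
open import Data.List.Properties using (length-map; length-++)
open import Data.List.Membership.Propositional using (_∈_)
open import Data.List.Membership.Propositional.Properties
  using (∈-map⁺; ∈-map⁻; ∈-++⁺ˡ; ∈-++⁺ʳ; ∈-++⁻; ∈-cartesianProductWith⁺; ∈-cartesianProductWith⁻)
open import Data.List.Relation.Binary.Disjoint.Propositional using (Disjoint)
open import Data.List.Relation.Unary.All using (_∷_)
open import Data.List.Relation.Unary.All.Properties using (¬Any⇒All¬)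
open import Data.List.Relation.Unary.Any using (here; there)
open import Data.List.Relation.Unary.Unique.Propositional using (Unique; []; _∷_)
open import Data.List.Relation.Unary.Unique.Propositional.Properties
  using (++⁺; map⁺; cartesianProductWith⁺)
open import Data.Nat using (ℕ; zero; suc; _+_; _*_; _≤_; _<_; _^_; _⊔_; z≤n; s≤s; s≤s⁻¹)
open import Data.Nat.Combinatorics using (_C_; nC1≡n; nCk+nC[k+1]≡[n+1]C[k+1])
open import Data.Nat.Properties
open import Data.Nat.Tactic.RingSolver using (solve-∀)
import Data.Product
open import Data.Product using (_×_; _,_; _,′_; Σ; proj₁; proj₂; map₂)
open import Data.Sum using (inj₁; inj₂)
open import Function using (_∘_)
open import Function.Bundles using (_⇔_; mk⇔; Equivalence)
open import Relation.Binary.PropositionalEquality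
  using (_≡_; _≢_; refl; sym; trans; cong; cong₂; subst; subst₂; module ≡-Reasoning)
open import Relation.Nullary using (yes; no)

cellRadius : ℤ → ℕ
cellRadius (+ k)    = suc k
cellRadius -[1+ k ] = suc k

suc∣2i+1∣≡2*cellRadius : ∀ i → suc ∣ + 2 ℤ.* i ℤ.+ 1ℤ ∣ ≡ 2 * cellRadius i
suc∣2i+1∣≡2*cellRadius (+ k) = begin
  suc ∣ + 2 ℤ.* + k ℤ.+ 1ℤ ∣ ≡⟨ cong (λ z → suc ∣ z ℤ.+ 1ℤ ∣) (sym (ℤₚ.pos-* 2 k)) ⟩
  suc (2 * k + 1)           ≡⟨ solve k ⟩
  2 * suc k                 ∎
  where
  open ≡-Reasoning
  solve : ∀ k → suc (2 * k + 1) ≡ 2 * suc k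
  solve = solve-∀
suc∣2i+1∣≡2*cellRadius -[1+ k ] = begin
  suc ∣ + 2 ℤ.* -[1+ k ] ℤ.+ 1ℤ ∣    ≡⟨ cong (suc ∘ ∣_∣) (negate (+ k)) ⟩
  suc ∣ ℤ.- (+ 2 ℤ.* + k ℤ.+ 1ℤ) ∣  ≡⟨ cong suc (ℤₚ.∣-i∣≡∣i∣ (+ 2 ℤ.* + k ℤ.+ 1ℤ)) ⟩
  suc ∣ + 2 ℤ.* + k ℤ.+ 1ℤ ∣        ≡⟨ suc∣2i+1∣≡2*cellRadius (+ k) ⟩
  2 * suc k                         ∎
  where
  open ≡-Reasoning
  negate : ∀ t → + 2 ℤ.* ℤ.- (1ℤ ℤ.+ t) ℤ.+ 1ℤ ≡ ℤ.- (+ 2 ℤ.* t ℤ.+ 1ℤ)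
  negate = ℤSolver.solve-∀

inAztecCell⇔ : ∀ n i j → InAztecCell n i j ⇔ cellRadius i + cellRadius j ≤ suc n
inAztecCell⇔ n i j = mk⇔
  (λ h → *-cancelˡ-≤ 2 (subst₂ _≤_ (sym twice) (sym (*-suc 2 n)) (s≤s (s≤s h))))
  (λ h → +-cancelˡ-≤ 2 _ _ (subst₂ _≤_ twice (*-suc 2 n) (*-monoʳ-≤ 2 h)))
  where
  open ≡-Reasoning
  a b : ℕ
  a = ∣ + 2 ℤ.* i ℤ.+ 1ℤ ∣
  b = ∣ + 2 ℤ.* j ℤ.+ 1ℤ ∣
  twice : 2 * (cellRadius i + cellRadius j) ≡ 2 + (a + b)
  twice = begin
    2 * (cellRadius i + cellRadius j)     ≡⟨ *-distribˡ-+ 2 (cellRadius i) (cellRadius j) ⟩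
    2 * cellRadius i + 2 * cellRadius j   ≡⟨ cong₂ _+_ (sym (suc∣2i+1∣≡2*cellRadius i)) (sym (suc∣2i+1∣≡2*cellRadius j)) ⟩
    suc a + suc b                         ≡⟨ cong suc (+-suc a b) ⟩
    2 + (a + b)                           ∎

Interval : Set
Interval = ℤ × ℤ

NonEmpty : Interval → Set
NonEmpty (x , x') = x ℤ.< x'

radius : Interval → ℕ
radius (x , x') = ∣ x ∣ ⊔ ∣ x' ∣

∣i∣≤cellRadius : ∀ i → ∣ i ∣ ≤ cellRadius i
∣i∣≤cellRadius (+ k)    = n≤1+n k
∣i∣≤cellRadius -[1+ k ] = ≤-refl

∣i∣≤cellRadius[pred[i]] : ∀ i → ∣ i ∣ ≤ cellRadius (ℤ.pred i)
∣i∣≤cellRadius[pred[i]] (+ zero)  = z≤n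
∣i∣≤cellRadius[pred[i]] (+ suc k) = ≤-refl
∣i∣≤cellRadius[pred[i]] -[1+ k ]  = n≤1+n (suc k)

cellRadius≤radius : ∀ {x x' i} → x ℤ.≤ i → i ℤ.< x' → cellRadius i ≤ radius (x , x')
cellRadius≤radius {x} {+ k'} {+ k} _ (+<+ k<k') = ≤-trans k<k' (m≤n⊔m ∣ x ∣ k')
cellRadius≤radius { -[1+ j ]} {x'} { -[1+ k ]} (-≤- k≤j) _ = ≤-trans (s≤s k≤j) (m≤m⊔n (suc j) ∣ x' ∣)

radius≤cornerCellRadii : ∀ x x' → radius (x , x') ≤ cellRadius x ⊔ cellRadius (ℤ.pred x')
radius≤cornerCellRadii x x' = ⊔-mono-≤ (∣i∣≤cellRadius x) (∣i∣≤cellRadius[pred[i]] x')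

nonEmpty⇒radius>0 : ∀ I → NonEmpty I → 0 < radius I
nonEmpty⇒radius>0 (+ _    , _) x<x' = ≤-trans (s≤s z≤n) (cellRadius≤radius ℤₚ.≤-refl x<x')
nonEmpty⇒radius>0 (-[1+ _ ] , _) x<x' = ≤-trans (s≤s z≤n) (cellRadius≤radius ℤₚ.≤-refl x<x')

⊔+⊔-lub : ∀ {k} a b c d → a + c ≤ k → a + d ≤ k → b + c ≤ k → b + d ≤ k → (a ⊔ b) + (c ⊔ d) ≤ k
⊔+⊔-lub {k} a b c d ac ad bc bd = begin
  (a ⊔ b) + (c ⊔ d)                         ≡⟨ +-distribʳ-⊔ (c ⊔ d) a b ⟩
  (a + (c ⊔ d)) ⊔ (b + (c ⊔ d))             ≡⟨ cong₂ _⊔_ (+-distribˡ-⊔ a c d) (+-distribˡ-⊔ b c d) ⟩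
  ((a + c) ⊔ (a + d)) ⊔ ((b + c) ⊔ (b + d)) ≤⟨ ⊔-lub (⊔-lub ac ad) (⊔-lub bc bd) ⟩
  k                                         ∎
  where open ≤-Reasoning

xSide ySide : LatticeRect → Interval
xSide (rect x x' _ _) = x , x'
ySide (rect _ _ y y') = y , y'

RadiiWithin : ℕ → LatticeRect → Set
RadiiWithin N v =
  NonEmpty (xSide v) × NonEmpty (ySide v) × radius (xSide v) + radius (ySide v) ≤ N

containedInAztec⇔radiiWithin : ∀ n v → ContainedInAztec n v ⇔ RadiiWithin (suc n) v
containedInAztec⇔radiiWithin n (rect x x' y y') = mk⇔ to from
  where
  to : ContainedInAztec n (rect x x' y y') → RadiiWithin (suc n) (rect x x' y y')
  to (x<x' , y<y' , inside) = x<x' , y<y' , (begin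
    radius (x , x') + radius (y , y')
      ≤⟨ +-mono-≤ (radius≤cornerCellRadii x x') (radius≤cornerCellRadii y y') ⟩
    (cellRadius x ⊔ cellRadius (ℤ.pred x')) + (cellRadius y ⊔ cellRadius (ℤ.pred y'))
      ≤⟨ ⊔+⊔-lub (cellRadius x) (cellRadius (ℤ.pred x')) (cellRadius y) (cellRadius (ℤ.pred y'))
           (corner (first x<x') (first y<y')) (corner (first x<x') (last y<y'))
           (corner (last x<x') (first y<y')) (corner (last x<x') (last y<y')) ⟩
    suc n ∎)
    where
    open ≤-Reasoning
    first : ∀ {z z'} → z ℤ.< z' → z ℤ.≤ z × z ℤ.< z'
    first z<z' = ℤₚ.≤-refl , z<z'
    last : ∀ {z z'} → z ℤ.< z' → z ℤ.≤ ℤ.pred z' × ℤ.pred z' ℤ.< z'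
    last z<z' = ℤₚ.i<j⇒i≤pred[j] z<z' , ℤₚ.i≤pred[j]⇒i<j ℤₚ.≤-refl
    corner : ∀ {i j} → x ℤ.≤ i × i ℤ.< x' → y ℤ.≤ j × j ℤ.< y' → cellRadius i + cellRadius j ≤ suc n
    corner {i} {j} (x≤i , i<x') (y≤j , j<y') =
      Equivalence.to (inAztecCell⇔ n i j) (inside i j x≤i i<x' y≤j j<y')
  from : RadiiWithin (suc n) (rect x x' y y') → ContainedInAztec n (rect x x' y y')
  from (x<x' , y<y' , radii≤) = x<x' , y<y' , λ i j x≤i i<x' y≤j j<y' →
    Equivalence.from (inAztecCell⇔ n i j)
      (≤-trans (+-mono-≤ (cellRadius≤radius x≤i i<x') (cellRadius≤radius y≤j j<y')) radii≤)

cells : ℕ → List ℤ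
cells zero    = []
cells (suc k) = -[1+ k ] ∷ + k ∷ cells k

∈-cells⁻ : ∀ {k i} → i ∈ cells k → cellRadius i ≤ k
∈-cells⁻ {suc k} (here refl)         = ≤-refl
∈-cells⁻ {suc k} (there (here refl)) = ≤-refl
∈-cells⁻ {suc k} (there (there i∈))  = m≤n⇒m≤1+n (∈-cells⁻ i∈)

∈-cells⁺ : ∀ {k} i → cellRadius i ≤ k → i ∈ cells k
∈-cells⁺ {zero} (+ _)      ()
∈-cells⁺ {zero} -[1+ _ ]   ()
∈-cells⁺ {suc k} i r≤1+k with m≤n⇒m<n∨m≡n r≤1+k
... | inj₁ r≤k = there (there (∈-cells⁺ i (s≤s⁻¹ r≤k)))
... | inj₂ r≡1+k = outermost i r≡1+k
  where
  outermost : ∀ i → cellRadius i ≡ suc k → i ∈ cells (suc k)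
  outermost (+ _)      refl = there (here refl)
  outermost -[1+ _ ]   refl = here refl

cells-unique : ∀ k → Unique (cells k)
cells-unique zero    = []
cells-unique (suc k) =
  ((λ ()) ∷ ¬Any⇒All¬ (cells k) (1+n≰n ∘ ∈-cells⁻)) ∷
  ¬Any⇒All¬ (cells k) (1+n≰n ∘ ∈-cells⁻) ∷
  cells-unique k

length-cells : ∀ k → length (cells k) ≡ k + k
length-cells zero    = refl
length-cells (suc k) = cong suc (trans (cong suc (length-cells k)) (sym (+-suc k k)))

endpoints : ℕ → List ℤ
endpoints k = + k ∷ cells k

∈-endpoints⁻ : ∀ {k z} → z ∈ endpoints k → ∣ z ∣ ≤ k
∈-endpoints⁻         (here refl) = ≤-refl
∈-endpoints⁻ {z = z} (there z∈)  = ≤-trans (∣i∣≤cellRadius z) (∈-cells⁻ z∈)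

∈-endpoints⁺ : ∀ {k} z → ∣ z ∣ ≤ k → z ∈ endpoints k
∈-endpoints⁺ (+ j) j≤k with m≤n⇒m<n∨m≡n j≤k
... | inj₁ j<k = there (∈-cells⁺ (+ j) j<k)
... | inj₂ refl = here refl
∈-endpoints⁺ -[1+ j ] j<k = there (∈-cells⁺ -[1+ j ] j<k)

endpoints-unique : ∀ k → Unique (endpoints k)
endpoints-unique k = ¬Any⇒All¬ (cells k) (1+n≰n ∘ ∈-cells⁻) ∷ cells-unique k

cellRadius≤n⇒i<n : ∀ {n} i → cellRadius i ≤ n → i ℤ.< + n
cellRadius≤n⇒i<n (+ _)    j<n = +<+ j<n
cellRadius≤n⇒i<n -[1+ _ ] _   = -<+

i<n∧∣i∣≤n⇒cellRadius≤n : ∀ {n} i → i ℤ.< + n → ∣ i ∣ ≤ n → cellRadius i ≤ n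
i<n∧∣i∣≤n⇒cellRadius≤n (+ _)    (+<+ j<n) _   = j<n
i<n∧∣i∣≤n⇒cellRadius≤n -[1+ _ ] _         j<n = j<n

∣i∣≤n⇒-[1+n]<i : ∀ {n} i → ∣ i ∣ ≤ n → -[1+ n ] ℤ.< i
∣i∣≤n⇒-[1+n]<i (+ _)    _   = -<+
∣i∣≤n⇒-[1+n]<i -[1+ _ ] j<n = -<- j<n

m⊔n≡1+k∧n≤k⇒m≡1+k : ∀ {m n k} → m ⊔ n ≡ suc k → n ≤ k → m ≡ suc k
m⊔n≡1+k∧n≤k⇒m≡1+k {m} {n} {k} m⊔n≡1+k n≤k with ⊔-sel m n
... | inj₁ m⊔n≡m = trans (sym m⊔n≡m) m⊔n≡1+k
... | inj₂ m⊔n≡n = ⊥-elim (1+n≰n (subst (_≤ k) (trans (sym m⊔n≡n) m⊔n≡1+k) n≤k))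

radiusExactly : ℕ → List Interval
radiusExactly k = map (_,′ + suc k) (cells (suc k)) ++ map (-[1+ k ] ,′_) (endpoints k)

∈-radiusExactly⁻ : ∀ {k I} → I ∈ radiusExactly k → NonEmpty I × radius I ≡ suc k
∈-radiusExactly⁻ {k} I∈ with ∈-++⁻ (map (_,′ + suc k) (cells (suc k))) I∈
... | inj₁ I∈ˡ with ∈-map⁻ (_,′ + suc k) I∈ˡ
...   | x , x∈ , refl =
  cellRadius≤n⇒i<n x (∈-cells⁻ x∈) , m≤n⇒m⊔n≡n (≤-trans (∣i∣≤cellRadius x) (∈-cells⁻ x∈))
∈-radiusExactly⁻ {k} I∈ | inj₂ I∈ʳ with ∈-map⁻ (-[1+ k ] ,′_) I∈ʳ
...   | x' , x'∈ , refl =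
  ∣i∣≤n⇒-[1+n]<i x' (∈-endpoints⁻ x'∈) , m≥n⇒m⊔n≡m (m≤n⇒m≤1+n (∈-endpoints⁻ x'∈))

leftEndpoint≡ : ∀ {k x x'} → x ℤ.< x' → ∣ x' ∣ ≤ k → ∣ x ∣ ≡ suc k → x ≡ -[1+ k ]
leftEndpoint≡ {x = -[1+ _ ]}          _          _    refl = refl
leftEndpoint≡ {x = + _} {+ _}          (+<+ x<x') x'≤k refl = ⊥-elim (<⇒≱ x<x' (m≤n⇒m≤1+n x'≤k))
leftEndpoint≡ {x = + _} { -[1+ _ ]}    ()         _    _

rightEndpoint≤ : ∀ {k x x'} → x ℤ.< x' → radius (x , x') ≡ suc k → x' ≢ + suc k → ∣ x' ∣ ≤ k
rightEndpoint≤ {x = x} {+ j} _ r≡1+k x'≢ =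
  s≤s⁻¹ (≤∧≢⇒< (m⊔n≤o⇒n≤o ∣ x ∣ j (≤-reflexive r≡1+k)) (x'≢ ∘ cong (+_)))
rightEndpoint≤ {x = -[1+ i ]} { -[1+ j ]} (-<- j<i) r≡1+k _ =
  ≤-trans j<i (s≤s⁻¹ (m⊔n≤o⇒m≤o (suc i) (suc j) (≤-reflexive r≡1+k)))
rightEndpoint≤ {x = + _} { -[1+ _ ]} () _ _

∈-radiusExactly⁺ : ∀ {k} I → NonEmpty I → radius I ≡ suc k → I ∈ radiusExactly k
∈-radiusExactly⁺ {k} (x , x') x<x' r≡1+k with x' ℤ.≟ + suc k
... | yes refl = ∈-++⁺ˡ (∈-map⁺ (_,′ + suc k)
  (∈-cells⁺ x (i<n∧∣i∣≤n⇒cellRadius≤n x x<x' (m⊔n≤o⇒m≤o ∣ x ∣ (suc k) (≤-reflexive r≡1+k)))))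
... | no x'≢ =
  subst (λ z → (z , x') ∈ radiusExactly k)
        (sym (leftEndpoint≡ x<x' ∣x'∣≤k (m⊔n≡1+k∧n≤k⇒m≡1+k r≡1+k ∣x'∣≤k)))
        (∈-++⁺ʳ (map (_,′ + suc k) (cells (suc k))) (∈-map⁺ (-[1+ k ] ,′_) (∈-endpoints⁺ x' ∣x'∣≤k)))
  where
  ∣x'∣≤k : ∣ x' ∣ ≤ k
  ∣x'∣≤k = rightEndpoint≤ x<x' r≡1+k x'≢

radiusExactly-unique : ∀ k → Unique (radiusExactly k)
radiusExactly-unique k =
  ++⁺ (map⁺ (cong proj₁) (cells-unique (suc k))) (map⁺ (cong proj₂) (endpoints-unique k)) disjoint
  where
  disjoint : Disjoint (map (_,′ + suc k) (cells (suc k))) (map (-[1+ k ] ,′_) (endpoints k))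
  disjoint (I∈ˡ , I∈ʳ) with ∈-map⁻ (_,′ + suc k) I∈ˡ | ∈-map⁻ (-[1+ k ] ,′_) I∈ʳ
  ... | _ , _ , refl | _ , x'∈ , refl = 1+n≰n (∈-endpoints⁻ x'∈)

length-radiusExactly : ∀ k → length (radiusExactly k) ≡ 4 * k + 3
length-radiusExactly k = begin
  length (radiusExactly k)
    ≡⟨ length-++ (map (_,′ + suc k) (cells (suc k))) ⟩
  length (map (_,′ + suc k) (cells (suc k))) + length (map (-[1+ k ] ,′_) (endpoints k))
    ≡⟨ cong₂ _+_ (length-map (_,′ + suc k) (cells (suc k))) (length-map (-[1+ k ] ,′_) (endpoints k)) ⟩
  length (cells (suc k)) + suc (length (cells k))
    ≡⟨ cong₂ (λ a b → a + suc b) (length-cells (suc k)) (length-cells k) ⟩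
  suc k + suc k + suc (k + k)
    ≡⟨ solve k ⟩
  4 * k + 3 ∎
  where
  open ≡-Reasoning
  solve : ∀ k → suc k + suc k + suc (k + k) ≡ 4 * k + 3
  solve = solve-∀

radiusAtMost : ℕ → List Interval
radiusAtMost zero    = []
radiusAtMost (suc m) = radiusAtMost m ++ radiusExactly m

∈-radiusAtMost⁻ : ∀ {m I} → I ∈ radiusAtMost m → NonEmpty I × radius I ≤ m
∈-radiusAtMost⁻ {suc m} I∈ with ∈-++⁻ (radiusAtMost m) I∈
... | inj₁ I∈≤ = map₂ m≤n⇒m≤1+n (∈-radiusAtMost⁻ I∈≤)
... | inj₂ I∈≡ = map₂ ≤-reflexive (∈-radiusExactly⁻ I∈≡)

∈-radiusAtMost⁺ : ∀ {m} I → NonEmpty I → radius I ≤ m → I ∈ radiusAtMost m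
∈-radiusAtMost⁺ {zero} (x , x') x<x' r≤0 = ⊥-elim (<⇒≱ (nonEmpty⇒radius>0 (x , x') x<x') r≤0)
∈-radiusAtMost⁺ {suc m} I I≠∅ r≤1+m with m≤n⇒m<n∨m≡n r≤1+m
... | inj₁ r≤m   = ∈-++⁺ˡ (∈-radiusAtMost⁺ I I≠∅ (s≤s⁻¹ r≤m))
... | inj₂ r≡1+m = ∈-++⁺ʳ (radiusAtMost m) (∈-radiusExactly⁺ I I≠∅ r≡1+m)

radiusAtMost-unique : ∀ m → Unique (radiusAtMost m)
radiusAtMost-unique zero    = []
radiusAtMost-unique (suc m) = ++⁺ (radiusAtMost-unique m) (radiusExactly-unique m)
  λ (I∈≤ , I∈≡) → 1+n≰n (subst (_≤ m) (proj₂ (∈-radiusExactly⁻ I∈≡)) (proj₂ (∈-radiusAtMost⁻ I∈≤)))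

length-radiusAtMost : ∀ m → length (radiusAtMost m) ≡ m * (2 * m + 1)
length-radiusAtMost zero    = refl
length-radiusAtMost (suc m) = begin
  length (radiusAtMost m ++ radiusExactly m)            ≡⟨ length-++ (radiusAtMost m) ⟩
  length (radiusAtMost m) + length (radiusExactly m)    ≡⟨ cong₂ _+_ (length-radiusAtMost m) (length-radiusExactly m) ⟩
  m * (2 * m + 1) + (4 * m + 3)                         ≡⟨ solve m ⟩
  suc m * (2 * suc m + 1)                               ∎
  where
  open ≡-Reasoning
  solve : ∀ m → m * (2 * m + 1) + (4 * m + 3) ≡ suc m * (2 * suc m + 1)
  solve = solve-∀

length-cartesianProductWith : ∀ {a b c} {A : Set a} {B : Set b} {C : Set c} (f : A → B → C) xs ys →
                              length (cartesianProductWith f xs ys) ≡ length xs * length ys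
length-cartesianProductWith f []       ys = refl
length-cartesianProductWith f (x ∷ xs) ys = begin
  length (map (f x) ys ++ cartesianProductWith f xs ys)
    ≡⟨ length-++ (map (f x) ys) ⟩
  length (map (f x) ys) + length (cartesianProductWith f xs ys)
    ≡⟨ cong₂ _+_ (length-map (f x) ys) (length-cartesianProductWith f xs ys) ⟩
  length ys + length xs * length ys ∎
  where open ≡-Reasoning

toRect : Interval → Interval → LatticeRect
toRect (x , x') (y , y') = rect x x' y y'

toRect-injective : ∀ {I I' J J'} → toRect I J ≡ toRect I' J' → I ≡ I' × J ≡ J'
toRect-injective {_ , _} {_ , _} {_ , _} {_ , _} refl = refl , refl

rects : List Interval → List Interval → List LatticeRect
rects = cartesianProductWith toRect

∈-rects⁻ : ∀ A B {v} → v ∈ rects A B → xSide v ∈ A × ySide v ∈ B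
∈-rects⁻ A B v∈ with ∈-cartesianProductWith⁻ toRect A B v∈
... | (_ , _) , (_ , _) , I∈ , J∈ , refl = I∈ , J∈

∈-rects⁺ : ∀ {A B} v → xSide v ∈ A → ySide v ∈ B → v ∈ rects A B
∈-rects⁺ (rect _ _ _ _) = ∈-cartesianProductWith⁺ toRect

rects-unique : ∀ {A B} → Unique A → Unique B → Unique (rects A B)
rects-unique = cartesianProductWith⁺ toRect toRect-injective

layers : ℕ → ℕ → List LatticeRect
layers a zero    = []
layers a (suc m) = rects (radiusExactly a) (radiusAtMost (suc m)) ++ layers (suc a) m

r+s≤1+a+m∧a<r⇒s≤m : ∀ {r s a m} → r + s ≤ suc (a + m) → a < r → s ≤ m
r+s≤1+a+m∧a<r⇒s≤m {_} {s} {a} {m} r+s≤ a<r = +-cancelˡ-≤ (suc a) s m (≤-trans (+-monoˡ-≤ s a<r) r+s≤)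

∈-layers⁻ : ∀ a m {v} → v ∈ layers a m → RadiiWithin (suc (a + m)) v × a < radius (xSide v)
∈-layers⁻ a (suc m) {v} v∈ with ∈-++⁻ (rects (radiusExactly a) (radiusAtMost (suc m))) v∈
... | inj₁ v∈ˡ with ∈-rects⁻ (radiusExactly a) (radiusAtMost (suc m)) v∈ˡ
...   | I∈ , J∈ with ∈-radiusExactly⁻ I∈ | ∈-radiusAtMost⁻ J∈
...     | I≠∅ , r≡1+a | J≠∅ , s≤1+m = (I≠∅ , J≠∅ , r+s≤) , ≤-reflexive (sym r≡1+a)
  where
  r+s≤ : radius (xSide v) + radius (ySide v) ≤ suc (a + suc m)
  r+s≤ = subst (λ r → r + radius (ySide v) ≤ suc (a + suc m)) (sym r≡1+a) (+-monoʳ-≤ (suc a) s≤1+m)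
∈-layers⁻ a (suc m) {v} v∈ | inj₂ v∈ʳ =
  Data.Product.map (subst (λ N → RadiiWithin N v) (cong suc (sym (+-suc a m)))) <⇒≤
                   (∈-layers⁻ (suc a) m v∈ʳ)

∈-layers⁺ : ∀ a m v → RadiiWithin (suc (a + m)) v → a < radius (xSide v) → v ∈ layers a m
∈-layers⁺ a zero v (_ , J≠∅ , r+s≤) a<r =
  ⊥-elim (<⇒≱ (nonEmpty⇒radius>0 (ySide v) J≠∅) (r+s≤1+a+m∧a<r⇒s≤m r+s≤ a<r))
∈-layers⁺ a (suc m) v (I≠∅ , J≠∅ , r+s≤) a<r with radius (xSide v) ≟ suc a
... | yes r≡1+a = ∈-++⁺ˡ (∈-rects⁺ v (∈-radiusExactly⁺ (xSide v) I≠∅ r≡1+a)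
                                      (∈-radiusAtMost⁺ (ySide v) J≠∅ (r+s≤1+a+m∧a<r⇒s≤m r+s≤ a<r)))
... | no r≢1+a = ∈-++⁺ʳ (rects (radiusExactly a) (radiusAtMost (suc m)))
  (∈-layers⁺ (suc a) m v (I≠∅ , J≠∅ , r+s≤′) (≤∧≢⇒< a<r (r≢1+a ∘ sym)))
  where
  r+s≤′ : radius (xSide v) + radius (ySide v) ≤ suc (suc a + m)
  r+s≤′ = subst (radius (xSide v) + radius (ySide v) ≤_) (cong suc (+-suc a m)) r+s≤

layers-unique : ∀ a m → Unique (layers a m)
layers-unique a zero    = []
layers-unique a (suc m) =
  ++⁺ (rects-unique (radiusExactly-unique a) (radiusAtMost-unique (suc m))) (layers-unique (suc a) m)
    disjoint
  where
  disjoint : Disjoint (rects (radiusExactly a) (radiusAtMost (suc m))) (layers (suc a) m)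
  disjoint {v} (v∈ˡ , v∈ʳ) = <-irrefl (sym r≡1+a) (proj₂ (∈-layers⁻ (suc a) m v∈ʳ))
    where
    r≡1+a : radius (xSide v) ≡ suc a
    r≡1+a = proj₂ (∈-radiusExactly⁻ (proj₁ (∈-rects⁻ (radiusExactly a) (radiusAtMost (suc m)) v∈ˡ)))

-- 6 · Σ_{t=1}^{m} (4 (a + m - t) + 3) · t (2t + 1): the layer whose x-sides have radius a + m + 1 - t
-- pairs 4 (a + m - t) + 3 of them with the t (2t + 1) intervals of radius at most t.
sixLayersSize : ℕ → ℕ → ℕ
sixLayersSize a m = 4 * a * (m * (m + 1) * (4 * m + 5)) + m * (m + 1) * (4 * m * m + 12 * m + 11)

sixfold-length-layers : ∀ a m → 6 * length (layers a m) ≡ sixLayersSize a m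
sixfold-length-layers a zero    = solve a
  where
  solve : ∀ a → 0 ≡ 4 * a * (0 * (0 + 1) * (4 * 0 + 5)) + 0 * (0 + 1) * (4 * 0 * 0 + 12 * 0 + 11)
  solve = solve-∀
sixfold-length-layers a (suc m) = begin
  6 * length (rects E A ++ layers (suc a) m)                 ≡⟨ cong (6 *_) (length-++ (rects E A)) ⟩
  6 * (length (rects E A) + length (layers (suc a) m))       ≡⟨ *-distribˡ-+ 6 (length (rects E A)) _ ⟩
  6 * length (rects E A) + 6 * length (layers (suc a) m)
    ≡⟨ cong₂ (λ p q → 6 * p + q) (length-cartesianProductWith toRect E A) (sixfold-length-layers (suc a) m) ⟩
  6 * (length E * length A) + sixLayersSize (suc a) m
    ≡⟨ cong₂ (λ p q → 6 * (p * q) + sixLayersSize (suc a) m) (length-radiusExactly a) (length-radiusAtMost (suc m)) ⟩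
  6 * ((4 * a + 3) * (suc m * (2 * suc m + 1))) + sixLayersSize (suc a) m
    ≡⟨ solve a m ⟩
  sixLayersSize a (suc m)                                    ∎
  where
  open ≡-Reasoning
  E A : List Interval
  E = radiusExactly a
  A = radiusAtMost (suc m)
  solve : ∀ a m →
    6 * ((4 * a + 3) * (suc m * (2 * suc m + 1)))
      + (4 * suc a * (m * (m + 1) * (4 * m + 5)) + m * (m + 1) * (4 * m * m + 12 * m + 11))
    ≡ 4 * a * (suc m * (suc m + 1) * (4 * suc m + 5)) + suc m * (suc m + 1) * (4 * suc m * suc m + 12 * suc m + 11)
  solve = solve-∀

n^2≡n*n : ∀ n → n ^ 2 ≡ n * n
n^2≡n*n n = cong (n *_) (*-identityʳ n)

rectangles : ℕ → List LatticeRect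
rectangles n = layers 0 n

∈-rectangles⇔containedInAztec : ∀ n v → v ∈ rectangles n ⇔ ContainedInAztec n v
∈-rectangles⇔containedInAztec n v = mk⇔
  (Equivalence.from (containedInAztec⇔radiiWithin n v) ∘ proj₁ ∘ ∈-layers⁻ 0 n)
  (λ contained → let radiiWithin = Equivalence.to (containedInAztec⇔radiiWithin n v) contained in
    ∈-layers⁺ 0 n v radiiWithin (nonEmpty⇒radius>0 (xSide v) (proj₁ radiiWithin)))

sixfold-length-rectangles : ∀ n → 6 * length (rectangles n) ≡ n * (n + 1) * (4 * n ^ 2 + 12 * n + 11)
sixfold-length-rectangles n = begin
  6 * length (layers 0 n)                          ≡⟨ sixfold-length-layers 0 n ⟩
  sixLayersSize 0 n                                ≡⟨ solve n ⟩
  n * (n + 1) * (4 * (n * n) + 12 * n + 11)        ≡⟨ cong (λ t → n * (n + 1) * (4 * t + 12 * n + 11)) (sym (n^2≡n*n n)) ⟩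
  n * (n + 1) * (4 * n ^ 2 + 12 * n + 11)          ∎
  where
  open ≡-Reasoning
  solve : ∀ n → 4 * 0 * (n * (n + 1) * (4 * n + 5)) + n * (n + 1) * (4 * n * n + 12 * n + 11)
              ≡ n * (n + 1) * (4 * (n * n) + 12 * n + 11)
  solve = solve-∀

*-pascal : ∀ c n k → c * (suc n C suc k) ≡ c * (n C k) + c * (n C suc k)
*-pascal c n k = trans (cong (c *_) (sym (nCk+nC[k+1]≡[n+1]C[k+1] n k))) (*-distribˡ-+ c (n C k) (n C suc k))

2*[1+m]C2≡[1+m]*m : ∀ m → 2 * ((1 + m) C 2) ≡ (1 + m) * m
2*[1+m]C2≡[1+m]*m zero    = refl
2*[1+m]C2≡[1+m]*m (suc m) = begin
  2 * ((2 + m) C 2)                      ≡⟨ *-pascal 2 (1 + m) 1 ⟩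
  2 * ((1 + m) C 1) + 2 * ((1 + m) C 2)  ≡⟨ cong₂ (λ p q → 2 * p + q) (nC1≡n (1 + m)) (2*[1+m]C2≡[1+m]*m m) ⟩
  2 * (1 + m) + (1 + m) * m              ≡⟨ solve m ⟩
  (2 + m) * (1 + m)                      ∎
  where
  open ≡-Reasoning
  solve : ∀ m → 2 * (1 + m) + (1 + m) * m ≡ (2 + m) * (1 + m)
  solve = solve-∀

6*[2+m]C3≡[2+m]*[1+m]*m : ∀ m → 6 * ((2 + m) C 3) ≡ (2 + m) * (1 + m) * m
6*[2+m]C3≡[2+m]*[1+m]*m zero    = refl
6*[2+m]C3≡[2+m]*[1+m]*m (suc m) = begin
  6 * ((3 + m) C 3)                             ≡⟨ *-pascal 6 (2 + m) 2 ⟩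
  6 * ((2 + m) C 2) + 6 * ((2 + m) C 3)         ≡⟨ cong (_+ 6 * ((2 + m) C 3)) (*-assoc 3 2 ((2 + m) C 2)) ⟩
  3 * (2 * ((2 + m) C 2)) + 6 * ((2 + m) C 3)   ≡⟨ cong₂ (λ p q → 3 * p + q) (2*[1+m]C2≡[1+m]*m (suc m))
                                                                              (6*[2+m]C3≡[2+m]*[1+m]*m m) ⟩
  3 * ((2 + m) * (1 + m)) + (2 + m) * (1 + m) * m ≡⟨ solve m ⟩
  (3 + m) * (2 + m) * (1 + m)                   ∎
  where
  open ≡-Reasoning
  solve : ∀ m → 3 * ((2 + m) * (1 + m)) + (2 + m) * (1 + m) * m ≡ (3 + m) * (2 + m) * (1 + m)
  solve = solve-∀

24*[3+m]C4≡[3+m]*[2+m]*[1+m]*m : ∀ m → 24 * ((3 + m) C 4) ≡ (3 + m) * (2 + m) * (1 + m) * m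
24*[3+m]C4≡[3+m]*[2+m]*[1+m]*m zero    = refl
24*[3+m]C4≡[3+m]*[2+m]*[1+m]*m (suc m) = begin
  24 * ((4 + m) C 4)                                ≡⟨ *-pascal 24 (3 + m) 3 ⟩
  24 * ((3 + m) C 3) + 24 * ((3 + m) C 4)           ≡⟨ cong (_+ 24 * ((3 + m) C 4)) (*-assoc 4 6 ((3 + m) C 3)) ⟩
  4 * (6 * ((3 + m) C 3)) + 24 * ((3 + m) C 4)      ≡⟨ cong₂ (λ p q → 4 * p + q) (6*[2+m]C3≡[2+m]*[1+m]*m (suc m))
                                                                                 (24*[3+m]C4≡[3+m]*[2+m]*[1+m]*m m) ⟩
  4 * ((3 + m) * (2 + m) * (1 + m)) + (3 + m) * (2 + m) * (1 + m) * m ≡⟨ solve m ⟩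
  (4 + m) * (3 + m) * (2 + m) * (1 + m)             ∎
  where
  open ≡-Reasoning
  solve : ∀ m → 4 * ((3 + m) * (2 + m) * (1 + m)) + (3 + m) * (2 + m) * (1 + m) * m
              ≡ (4 + m) * (3 + m) * (2 + m) * (1 + m)
  solve = solve-∀

-- Written as k + n, the arguments of _C_ reduce to the shape 3 + m used by 24*[3+m]C4≡[3+m]*[2+m]*[1+m]*m.
sixfold-binomialSum : ∀ n → 6 * (9 * ((n + 3) C 4) + 6 * ((n + 2) C 4) + (n + 1) C 4)
                            ≡ n * (n + 1) * (4 * n ^ 2 + 12 * n + 11)
sixfold-binomialSum n rewrite +-comm n 3 | +-comm n 2 | +-comm n 1 = commuted n
  where
  open ≡-Reasoning
  commuted : ∀ n → 6 * (9 * ((3 + n) C 4) + 6 * ((2 + n) C 4) + (1 + n) C 4)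
                   ≡ n * (1 + n) * (4 * n ^ 2 + 12 * n + 11)
  commuted 0             = refl
  commuted 1             = refl
  commuted (suc (suc m)) = *-cancelˡ-≡ _ _ 4 (begin
    4 * (6 * (9 * ((5 + m) C 4) + 6 * ((4 + m) C 4) + (3 + m) C 4))
      ≡⟨ distribute ((5 + m) C 4) ((4 + m) C 4) ((3 + m) C 4) ⟩
    9 * (24 * ((5 + m) C 4)) + 6 * (24 * ((4 + m) C 4)) + 24 * ((3 + m) C 4)
      ≡⟨ cong₂ _+_ (cong₂ (λ p q → 9 * p + 6 * q) (24*[3+m]C4≡[3+m]*[2+m]*[1+m]*m (2 + m))
                                                  (24*[3+m]C4≡[3+m]*[2+m]*[1+m]*m (1 + m)))
                   (24*[3+m]C4≡[3+m]*[2+m]*[1+m]*m m) ⟩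
    9 * ((5 + m) * (4 + m) * (3 + m) * (2 + m)) + 6 * ((4 + m) * (3 + m) * (2 + m) * (1 + m))
      + (3 + m) * (2 + m) * (1 + m) * m
      ≡⟨ solve m ⟩
    4 * ((2 + m) * (3 + m) * (4 * ((2 + m) * (2 + m)) + 12 * (2 + m) + 11))
      ≡⟨ cong (λ t → 4 * ((2 + m) * (3 + m) * (4 * t + 12 * (2 + m) + 11))) (sym (n^2≡n*n (2 + m))) ⟩
    4 * ((2 + m) * (3 + m) * (4 * (2 + m) ^ 2 + 12 * (2 + m) + 11)) ∎)
    where
    distribute : ∀ p q r → 4 * (6 * (9 * p + 6 * q + r)) ≡ 9 * (24 * p) + 6 * (24 * q) + 24 * r
    distribute = solve-∀
    solve : ∀ m → 9 * ((5 + m) * (4 + m) * (3 + m) * (2 + m)) + 6 * ((4 + m) * (3 + m) * (2 + m) * (1 + m))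
                    + (3 + m) * (2 + m) * (1 + m) * m
                ≡ 4 * ((2 + m) * (3 + m) * (4 * ((2 + m) * (2 + m)) + 12 * (2 + m) + 11))
    solve = solve-∀

mainTheorem1 : (n : ℕ) → 1 ≤ n →
    Σ (List LatticeRect) λ L →
      Unique L ×
      (∀ (r : LatticeRect) → (r ∈ L) ⇔ ContainedInAztec n r) ×
      (length L ≡ 9 * ((n + 3) C 4) + 6 * ((n + 2) C 4) + (n + 1) C 4) ×
      (6 * length L ≡ n * (n + 1) * (4 * n ^ 2 + 12 * n + 11))
mainTheorem1 n _ =
  rectangles n , layers-unique 0 n , ∈-rectangles⇔containedInAztec n ,
  *-cancelˡ-≡ _ _ 6 (trans (sixfold-length-rectangles n) (sym (sixfold-binomialSum n))) ,
  sixfold-length-rectangles n
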